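{- Let $m\geqslant 2$ and $m\leqslant\ell<2m$. The number of edges in the abelian Rauzy graph $G_{m,\ell}$ of order $\ell$ of $\mathbf{t}_m$ is $m(m^2-m+1)$.
   Context: $\mathcal{A}_m=\{0,\ldots,m-1\}=\mathbb{Z}/m\mathbb{Z}$; $\sigma_m$ is the morphism $\sigma_m(i)=i\,(i+1)\cdots(i+m-1)$ (letters mod $m$), and $\mathbf{t}_m=\lim_{j\to\infty}\sigma_m^j(0)$. $\Psi(w)$ denotes the Parikh vector of $w$. The abelian Rauzy graph $G_{m,\ell}$ has as vertices the Parikh vectors of factors of length $\ell$ of $\mathbf{t}_m$; for letters $a,b$ and a word $U$ such that $aUb$ is a factor of $\mathbf{t}_m$ of length $\ell+1$, there is a directed edge from $\Psi(aU)$ to $\Psi(Ub)$ labeled $(a,b)$ (an edge is determined by its source, target and label). -}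

module Defs where

open import Data.Nat using (ℕ; zero; suc; _+_; _*_; _∸_; _≡ᵇ_)
open import Data.Nat.DivMod using (_%_)
open import Data.Bool using (if_then_else_)
open import Data.List using (List; []; _∷_; map; upTo; concatMap; length)
open import Data.List.Membership.Propositional using (_∈_)
open import Data.List.Relation.Unary.Unique.Propositional using (Unique)
open import Data.Product using (_×_; _,_; ∃)
open import Relation.Binary.PropositionalEquality using (_≡_)

-- Letters of A_m are the naturals 0 .. m-1; reduction mod m
-- (for m = 0 this is never used, we just return x).
modL : ℕ → ℕ → ℕ
modL zero    x = x
modL (suc n) x = x % suc n

σ : ℕ → ℕ → List ℕ
σ m i = map (λ k → modL m (i + k)) (upTo m)

σ* : ℕ → List ℕ → List ℕ
σ* m w = concatMap (σ m) w

σ^ : ℕ → ℕ → List ℕ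
σ^ m zero    = 0 ∷ []
σ^ m (suc j) = σ* m (σ^ m j)

-- n-th letter of a list (0 if out of range)
nth : ℕ → List ℕ → ℕ
nth n       []       = 0
nth zero    (x ∷ xs) = x
nth (suc n) (x ∷ xs) = nth n xs

-- t_m = lim σ_m^j(0): its n-th letter is the n-th letter of σ_m^(n+1)(0),
-- which has length m^(n+1) > n for m ≥ 2 (the σ_m^j(0) are nested prefixes).
t : ℕ → ℕ → ℕ
t m n = nth n (σ^ m (suc n))

factor : ℕ → ℕ → ℕ → List ℕ
factor m i L = map (λ k → t m (i + k)) (upTo L)

count : ℕ → List ℕ → ℕ
count c []       = 0
count c (x ∷ xs) = (if c ≡ᵇ x then 1 else 0) + count c xs

Ψ : ℕ → List ℕ → List ℕ
Ψ m w = map (λ c → count c w) (upTo m)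

-- an edge: (source, target), label (a , b)
Edge : Set
Edge = (List ℕ × List ℕ) × (ℕ × ℕ)

-- the edge of G_{m,ℓ} induced by the factor aUb = t_m[i .. i+ℓ] (length ℓ+1):
-- from Ψ(aU) to Ψ(Ub), labelled (a, b)
edgeAt : ℕ → ℕ → ℕ → Edge
edgeAt m ℓ i = ((Ψ m (factor m i ℓ) , Ψ m (factor m (suc i) ℓ)) , (t m i , t m (i + ℓ)))

NumValues : {A : Set} → (ℕ → A) → ℕ → Set
NumValues {A} f N =
  ∃ λ (xs : List A) → Unique xs × length xs ≡ N
    × (∀ x → x ∈ xs → ∃ λ i → f i ≡ x)
    × (∀ i → f i ∈ xs)

NumEdges : ℕ → ℕ → ℕ → Set
NumEdges m ℓ N = NumValues (edgeAt m ℓ) N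

{-# OPTIONS --safe #-}
-- Write positions as i = q * m + r with r < m.  Then t_m(q m + r) ≡ t_m(q) + r (mod m), so t_m
-- is a sequence of blocks, each running once through all letters cyclically.  A factor aUb of
-- length ℓ + 1 = m + k + 1 (k < m) starting at i covers the end of block q and a cyclic run
-- ending at b in one of the next two blocks.  With y = t_m(q) and d the jump from y to the
-- letter indexing the block of b, one gets b ≡ a + ℓ + d and
--   Ψ(aUb) + Ψ(run of length d from y) = 1 + Ψ(run of length k + 1 + d from a).
-- An edge is determined by a, b and Ψ(aUb), hence by a and d when d = 0, and otherwise also by
-- the start y of a proper cyclic run, i.e. by r.  All m (1 + (m - 1) m) such data occur.
module Submission where

open import Defs
open import Data.Bool.Base using (true; false; T; if_then_else_)
open import Data.Bool.Properties using (T-≡)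
open import Data.List.Base using (List; []; _∷_; [_]; _++_; map; applyUpTo; upTo; length; cartesianProduct)
open import Data.List.Properties
  using (∷-injectiveˡ; ∷-injectiveʳ; map-upTo; map-id-local; map-cong-local; length-map; length-++; length-upTo; concatMap-++)
open import Data.List.Membership.Propositional using (_∈_)
open import Data.List.Membership.Propositional.Properties
  using (∈-map⁺; ∈-map⁻; ∈-upTo⁺; ∈-upTo⁻; ∈-cartesianProduct⁺; ∈-cartesianProduct⁻)
open import Data.List.Relation.Unary.All as All using ()
open import Data.List.Relation.Unary.AllPairs as AllPairs using (_∷_)
import Data.List.Relation.Unary.AllPairs.Properties as AllPairs
open import Data.List.Relation.Unary.Any using (here; there)
open import Data.List.Relation.Unary.Unique.Propositional using (Unique)
open import Data.List.Relation.Unary.Unique.Propositional.Properties using (cartesianProduct⁺; map⁺; upTo⁺)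
open import Data.Nat using (ℕ; _+_; _*_; _∸_; _≤_; _<_)
open import Data.Nat.Base using (zero; suc; pred; _^_; z<s; s<s; _≡ᵇ_; NonZero; >-nonZero)
open import Data.Nat.Properties
open import Data.Nat.DivMod
  using (_%_; _/_; m≡m%n+[m/n]*n; m%n%n≡m%n; [m+n]%n≡m%n; [m+kn]%n≡m%n; %-distribˡ-+; m<n⇒m%n≡m; m%n≤n; m%n<n;
         +-distrib-/-∣ˡ; m*n/n≡m; m<n⇒m/n≡0; m<n*o⇒m/o<n)
open import Data.Nat.Divisibility using (divides-refl)
open import Data.Nat.Tactic.RingSolver using (solve-∀)
open import Data.Product.Base using (_×_; _,_; ∃; proj₁; proj₂)
open import Data.Sum.Base using (_⊎_; inj₁; inj₂)
open import Data.Sum.Function.Propositional using (_⊎-⇔_)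
open import Data.Unit.Base using (tt)
open import Function.Base using (_∘_)
open import Function.Bundles using (_⇔_; mk⇔; Equivalence)
open import Function.Construct.Composition using (_⇔-∘_)
open import Function.Construct.Identity using (⇔-id)
open import Level using (0ℓ)
open import Relation.Binary.Bundles using (Setoid)
import Relation.Binary.Construct.On as On
open import Relation.Binary.PropositionalEquality hiding ([_])
import Relation.Binary.Reasoning.Setoid as SetoidReasoning
open import Relation.Nullary.Decidable.Core using (yes; no)
open import Relation.Nullary.Negation using (contradiction)

open Equivalence using (to; from)

private
  variable
    A K : Set

applyUpTo-+ : ∀ (f : ℕ → A) a b → applyUpTo f (a + b) ≡ applyUpTo f a ++ applyUpTo (f ∘ (a +_)) b
applyUpTo-+ f zero    b = refl
applyUpTo-+ f (suc a) b = cong (f 0 ∷_) (applyUpTo-+ (f ∘ suc) a b)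

applyUpTo-cong-< : ∀ {f g : ℕ → A} n → (∀ {j} → j < n → f j ≡ g j) → applyUpTo f n ≡ applyUpTo g n
applyUpTo-cong-< zero    _   = refl
applyUpTo-cong-< (suc n) f≗g = cong₂ _∷_ (f≗g z<s) (applyUpTo-cong-< n (f≗g ∘ s<s))

applyUpTo-≡⇒≗ : ∀ {f g : ℕ → A} n → applyUpTo f n ≡ applyUpTo g n → ∀ {j} → j < n → f j ≡ g j
applyUpTo-≡⇒≗ (suc n) eq {zero}  _         = ∷-injectiveˡ eq
applyUpTo-≡⇒≗ (suc n) eq {suc j} (s<s j<n) = applyUpTo-≡⇒≗ n (∷-injectiveʳ eq) j<n

length-cartesianProduct : ∀ {B : Set} (xs : List A) (ys : List B) →
  length (cartesianProduct xs ys) ≡ length xs * length ys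
length-cartesianProduct []       ys = refl
length-cartesianProduct (x ∷ xs) ys = begin
  length (map (x ,_) ys ++ cartesianProduct xs ys)       ≡⟨ length-++ (map (x ,_) ys) ⟩
  length (map (x ,_) ys) + length (cartesianProduct xs ys) ≡⟨ cong₂ _+_ (length-map (x ,_) ys) (length-cartesianProduct xs ys) ⟩
  length ys + length xs * length ys                       ∎
  where open ≡-Reasoning

nth-++ˡ : ∀ xs ys {n} → n < length xs → nth n (xs ++ ys) ≡ nth n xs
nth-++ˡ (x ∷ xs) ys {zero}  _         = refl
nth-++ˡ (x ∷ xs) ys {suc n} (s<s n<l) = nth-++ˡ xs ys n<l

nth-++ʳ : ∀ xs ys n → nth (length xs + n) (xs ++ ys) ≡ nth n ys
nth-++ʳ []       ys n = refl
nth-++ʳ (x ∷ xs) ys n = nth-++ʳ xs ys n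

nth-applyUpTo : ∀ (f : ℕ → ℕ) {n j} → j < n → nth j (applyUpTo f n) ≡ f j
nth-applyUpTo f {suc n} {zero}  _         = refl
nth-applyUpTo f {suc n} {suc j} (s<s j<n) = nth-applyUpTo (f ∘ suc) j<n

count-++ : ∀ c xs ys → count c (xs ++ ys) ≡ count c xs + count c ys
count-++ c []       ys = refl
count-++ c (x ∷ xs) ys = trans (cong (δ +_) (count-++ c xs ys)) (sym (+-assoc δ (count c xs) (count c ys)))
  where δ = if c ≡ᵇ x then 1 else 0

count-[-]-≡ : ∀ a → count a [ a ] ≡ 1
count-[-]-≡ a rewrite to T-≡ (≡⇒≡ᵇ a a refl) = refl

count-[-]-≢ : ∀ {c a} → c ≢ a → count c [ a ] ≡ 0
count-[-]-≢ {c} {a} c≢a with c ≡ᵇ a in eq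
... | true  = contradiction (≡ᵇ⇒≡ c a (subst T (sym eq) tt)) c≢a
... | false = refl

NumValues-byKeys : {f : ℕ → A} {key : ℕ → K} (ks : List K) (pos : K → ℕ) → Unique ks →
  (∀ i → key i ∈ ks) → (∀ {κ} → κ ∈ ks → key (pos κ) ≡ κ) →
  (∀ {i j} → f i ≡ f j ⇔ key i ≡ key j) → NumValues f (length ks)
NumValues-byKeys {f = f} {key} ks pos ks! key∈ks key-pos f≡⇔key≡ =
  map (f ∘ pos) ks , values! , length-map (f ∘ pos) ks , realised , covered
  where
  values! : Unique (map (f ∘ pos) ks)
  values! = AllPairs.map⁺ (AllPairs.map (_∘ to f≡⇔key≡) (AllPairs.map⁻ keys!))
    where
    keys! : Unique (map (key ∘ pos) ks)
    keys! = subst Unique (sym (map-id-local (All.tabulate key-pos))) ks!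
  realised : ∀ y → y ∈ map (f ∘ pos) ks → ∃ λ i → f i ≡ y
  realised y y∈ with κ , _ , refl ← ∈-map⁻ (f ∘ pos) y∈ = pos κ , refl
  covered : ∀ i → f i ∈ map (f ∘ pos) ks
  covered i = subst (_∈ map (f ∘ pos) ks) (from f≡⇔key≡ (key-pos (key∈ks i))) (∈-map⁺ (f ∘ pos) (key∈ks i))

factor-applyUpTo : ∀ m i n → factor m i n ≡ applyUpTo (λ j → t m (i + j)) n
factor-applyUpTo m i n = map-upTo (λ j → t m (i + j)) n

factor-+ : ∀ m i a b → factor m i (a + b) ≡ factor m i a ++ factor m (i + a) b
factor-+ m i a b = begin
  factor m i (a + b)                                                   ≡⟨ factor-applyUpTo m i (a + b) ⟩
  applyUpTo (λ j → t m (i + j)) (a + b)                                 ≡⟨ applyUpTo-+ _ a b ⟩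
  applyUpTo (λ j → t m (i + j)) a ++ applyUpTo (λ j → t m (i + (a + j))) b
    ≡⟨ cong₂ _++_ (sym (factor-applyUpTo m i a))
                  (trans (applyUpTo-cong-< b (λ {j} _ → cong (t m) (sym (+-assoc i a j)))) (sym (factor-applyUpTo m (i + a) b))) ⟩
  factor m i a ++ factor m (i + a) b                                    ∎
  where open ≡-Reasoning


module Parikh (m : ℕ) where

  infix 4 _∼_
  _∼_ : List ℕ → List ℕ → Set
  w ∼ w' = ∀ c → c < m → count c w ≡ count c w'

  Ψ-≡⇔∼ : ∀ w w' → Ψ m w ≡ Ψ m w' ⇔ w ∼ w'
  Ψ-≡⇔∼ w w' = mk⇔
    (λ eq c c<m → applyUpTo-≡⇒≗ m (trans (sym (map-upTo (λ c → count c w) m)) (trans eq (map-upTo _ m))) c<m)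
    (λ w∼w' → map-cong-local (All.tabulate (λ c∈ → w∼w' _ (∈-upTo⁻ c∈))))

module RauzyEdges (m ℓ : ℕ) where

  open Parikh m

  window : ℕ → List ℕ
  window i = factor m i (suc ℓ)

  window-∷ : ∀ i → window i ≡ [ t m i ] ++ factor m (suc i) ℓ
  window-∷ i = begin
    factor m i (1 + ℓ)                   ≡⟨ factor-+ m i 1 ℓ ⟩
    factor m i 1 ++ factor m (i + 1) ℓ   ≡⟨ cong₂ (λ a b → [ t m a ] ++ factor m b ℓ) (+-identityʳ i) (+-comm i 1) ⟩
    [ t m i ] ++ factor m (suc i) ℓ      ∎
    where open ≡-Reasoning

  window-∷ʳ : ∀ i → window i ≡ factor m i ℓ ++ [ t m (i + ℓ) ]
  window-∷ʳ i = begin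
    factor m i (suc ℓ)                   ≡⟨ cong (factor m i) (+-comm 1 ℓ) ⟩
    factor m i (ℓ + 1)                   ≡⟨ factor-+ m i ℓ 1 ⟩
    factor m i ℓ ++ factor m (i + ℓ) 1   ≡⟨ cong (λ a → factor m i ℓ ++ [ t m a ]) (+-identityʳ (i + ℓ)) ⟩
    factor m i ℓ ++ [ t m (i + ℓ) ]      ∎
    where open ≡-Reasoning

  count-window-∷ : ∀ c i → count c (window i) ≡ count c [ t m i ] + count c (factor m (suc i) ℓ)
  count-window-∷ c i = trans (cong (count c) (window-∷ i)) (count-++ c [ t m i ] (factor m (suc i) ℓ))

  count-window-∷ʳ : ∀ c i → count c (window i) ≡ count c (factor m i ℓ) + count c [ t m (i + ℓ) ]
  count-window-∷ʳ c i = trans (cong (count c) (window-∷ʳ i)) (count-++ c (factor m i ℓ) _)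

  -- Ψ(aU) and Ψ(Ub) are Ψ(aUb) minus one letter, so an edge is determined by a, b and Ψ(aUb).
  edgeAt-≡⇔ : ∀ {i j} → edgeAt m ℓ i ≡ edgeAt m ℓ j ⇔
    (t m i ≡ t m j × t m (i + ℓ) ≡ t m (j + ℓ) × window i ∼ window j)
  edgeAt-≡⇔ {i} {j} = mk⇔ edge⇒ ⇒edge
    where
    edge⇒ : edgeAt m ℓ i ≡ edgeAt m ℓ j → t m i ≡ t m j × t m (i + ℓ) ≡ t m (j + ℓ) × window i ∼ window j
    edge⇒ e = a≡ , b≡ , λ c c<m → trans (count-window-∷ʳ c i)
        (trans (cong₂ (λ n b → n + count c [ b ]) (aU∼ c c<m) b≡) (sym (count-window-∷ʳ c j)))
      where
      a≡ = cong (proj₁ ∘ proj₂) e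
      b≡ = cong (proj₂ ∘ proj₂) e
      aU∼ = to (Ψ-≡⇔∼ (factor m i ℓ) (factor m j ℓ)) (cong (proj₁ ∘ proj₁) e)
    ⇒edge : t m i ≡ t m j × t m (i + ℓ) ≡ t m (j + ℓ) × window i ∼ window j → edgeAt m ℓ i ≡ edgeAt m ℓ j
    ⇒edge (a≡ , b≡ , W∼) = cong₂ _,_
      (cong₂ _,_ (from (Ψ-≡⇔∼ (factor m i ℓ) (factor m j ℓ)) aU∼) (from (Ψ-≡⇔∼ (factor m (suc i) ℓ) (factor m (suc j) ℓ)) Ub∼))
      (cong₂ _,_ a≡ b≡)
      where
      aU∼ : factor m i ℓ ∼ factor m j ℓ
      aU∼ c c<m = +-cancelʳ-≡ _ _ _ (trans (sym (count-window-∷ʳ c i))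
        (trans (W∼ c c<m) (trans (count-window-∷ʳ c j) (cong (λ b → count c (factor m j ℓ) + count c [ b ]) (sym b≡)))))
      Ub∼ : factor m (suc i) ℓ ∼ factor m (suc j) ℓ
      Ub∼ c c<m = +-cancelˡ-≡ _ _ _ (trans (sym (count-window-∷ c i))
        (trans (W∼ c c<m) (trans (count-window-∷ c j) (cong (λ a → count c [ a ] + count c (factor m (suc j) ℓ)) (sym a≡)))))

module Residues (m : ℕ) .{{_ : NonZero m}} where

  open Parikh m

  infix 4 _≋_
  _≋_ : ℕ → ℕ → Set
  a ≋ b = a % m ≡ b % m

  ≋-setoid : Setoid 0ℓ 0ℓ
  ≋-setoid = On.setoid (setoid ℕ) (_% m)

  module ≋-Reasoning = SetoidReasoning ≋-setoid

  %-≋ : ∀ a → a % m ≋ a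
  %-≋ a = m%n%n≡m%n a m

  +m-≋ : ∀ a → a + m ≋ a
  +m-≋ a = [m+n]%n≡m%n a m

  +-≋ : ∀ {a b c d} → a ≋ b → c ≋ d → a + c ≋ b + d
  +-≋ {a} {b} {c} {d} a≋b c≋d = begin
    (a + c) % m             ≡⟨ %-distribˡ-+ a c m ⟩
    (a % m + c % m) % m     ≡⟨ cong₂ (λ x y → (x + y) % m) a≋b c≋d ⟩
    (b % m + d % m) % m     ≡⟨ %-distribˡ-+ b d m ⟨
    (b + d) % m             ∎
    where open ≡-Reasoning

  +ˡ-≋ : ∀ c {a b} → a ≋ b → c + a ≋ c + b
  +ˡ-≋ c = +-≋ {c} {c} refl

  +ʳ-≋ : ∀ c {a b} → a ≋ b → a + c ≋ b + c
  +ʳ-≋ c a≋b = +-≋ a≋b refl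

  ≋⇒≡ : ∀ {a b} → a < m → b < m → a ≋ b → a ≡ b
  ≋⇒≡ a<m b<m a≋b = trans (sym (m<n⇒m%n≡m a<m)) (trans a≋b (m<n⇒m%n≡m b<m))

  m∸[a%m]+a≋0 : ∀ a → m ∸ a % m + a ≋ 0
  m∸[a%m]+a≋0 a = begin
    m ∸ a % m + a       ≈⟨ +ˡ-≋ (m ∸ a % m) (%-≋ a) ⟨
    m ∸ a % m + a % m   ≡⟨ m∸n+n≡m (m%n≤n a m) ⟩
    0 + m               ≈⟨ +m-≋ 0 ⟩
    0                   ∎
    where open ≋-Reasoning

  ≋-cancelˡ : ∀ a {b c} → a + b ≋ a + c → b ≋ c
  ≋-cancelˡ a {b} {c} eq = begin
    b                   ≈⟨ +ʳ-≋ b (m∸[a%m]+a≋0 a) ⟨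
    a⁻ + a + b          ≡⟨ +-assoc a⁻ a b ⟩
    a⁻ + (a + b)        ≈⟨ +ˡ-≋ a⁻ eq ⟩
    a⁻ + (a + c)        ≡⟨ +-assoc a⁻ a c ⟨
    a⁻ + a + c          ≈⟨ +ʳ-≋ c (m∸[a%m]+a≋0 a) ⟩
    c                   ∎
    where
    open ≋-Reasoning
    a⁻ = m ∸ a % m

  ≋-cancelʳ : ∀ a {b c} → b + a ≋ c + a → b ≋ c
  ≋-cancelʳ a {b} {c} eq = ≋-cancelˡ a (subst₂ _≋_ (+-comm b a) (+-comm c a) eq)

  infixl 6 _⊖_
  _⊖_ : ℕ → ℕ → ℕ
  b ⊖ a = (m ∸ a % m + b) % m

  ⊖-< : ∀ b a → b ⊖ a < m
  ⊖-< b a = m%n<n (m ∸ a % m + b) m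

  +-⊖-≋ : ∀ a b → a + (b ⊖ a) ≋ b
  +-⊖-≋ a b = begin
    a + (b ⊖ a)         ≈⟨ +ˡ-≋ a (%-≋ (a⁻ + b)) ⟩
    a + (a⁻ + b)        ≡⟨ trans (sym (+-assoc a a⁻ b)) (cong (_+ b) (+-comm a a⁻)) ⟩
    a⁻ + a + b          ≈⟨ +ʳ-≋ b (m∸[a%m]+a≋0 a) ⟩
    b                   ∎
    where
    open ≋-Reasoning
    a⁻ = m ∸ a % m

  ⊖-unique : ∀ {a b o} → o < m → a + o ≋ b → b ⊖ a ≡ o
  ⊖-unique {a} {b} {o} o<m a+o≋b = ≋⇒≡ (⊖-< b a) o<m (≋-cancelˡ a (trans (+-⊖-≋ a b) (sym a+o≋b)))

  [q*m+n]/m≡q+n/m : ∀ q n → (q * m + n) / m ≡ q + n / m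
  [q*m+n]/m≡q+n/m q n = trans (+-distrib-/-∣ˡ n (divides-refl q)) (cong (_+ n / m) (m*n/n≡m q m))

  [q*m+r]/m≡q : ∀ q {r} → r < m → (q * m + r) / m ≡ q
  [q*m+r]/m≡q q {r} r<m = trans ([q*m+n]/m≡q+n/m q r) (trans (cong (q +_) (m<n⇒m/n≡0 r<m)) (+-identityʳ q))

  [q*m+r]%m≡r : ∀ q {r} → r < m → (q * m + r) % m ≡ r
  [q*m+r]%m≡r q {r} r<m = trans (cong (_% m) (+-comm (q * m) r)) (trans ([m+kn]%n≡m%n r q m) (m<n⇒m%n≡m r<m))

  run : ℕ → ℕ → List ℕ
  run y n = applyUpTo (λ j → (y + j) % m) n

  run-+ : ∀ y a b → run y (a + b) ≡ run y a ++ run (y + a) b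
  run-+ y a b = trans (applyUpTo-+ _ a b)
    (cong (run y a ++_) (applyUpTo-cong-< b (λ {j} _ → cong (_% m) (sym (+-assoc y a j)))))

  run-≋ : ∀ {y y'} → y ≋ y' → ∀ n → run y n ≡ run y' n
  run-≋ y≋y' n = applyUpTo-cong-< n (λ {j} _ → +ʳ-≋ j y≋y')

  count-run-+ : ∀ c y a b → count c (run y (a + b)) ≡ count c (run y a) + count c (run (y + a) b)
  count-run-+ c y a b = trans (cong (count c) (run-+ y a b)) (count-++ c (run y a) (run (y + a) b))

  count-run-suc : ∀ c y n → count c (run y (suc n)) ≡ count c (run y n) + count c [ (y + n) % m ]
  count-run-suc c y n = begin
    count c (run y (suc n))                              ≡⟨ cong (count c ∘ run y) (+-comm 1 n) ⟩
    count c (run y (n + 1))                              ≡⟨ count-run-+ c y n 1 ⟩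
    count c (run y n) + count c [ (y + n + 0) % m ]      ≡⟨ cong (λ a → count c (run y n) + count c [ a % m ]) (+-identityʳ (y + n)) ⟩
    count c (run y n) + count c [ (y + n) % m ]          ∎
    where open ≡-Reasoning

  offset-injective : ∀ y {o o'} → o < m → o' < m → (y + o) % m ≡ (y + o') % m → o ≡ o'
  offset-injective y o<m o'<m eq = ≋⇒≡ o<m o'<m (≋-cancelˡ y eq)

  count-run-∉ : ∀ y {o n} → n ≤ o → o < m → count ((y + o) % m) (run y n) ≡ 0
  count-run-∉ y {o} {zero}  _   _   = refl
  count-run-∉ y {o} {suc n} n<o o<m = begin
    count c (run y (suc n))                  ≡⟨ count-run-suc c y n ⟩
    count c (run y n) + count c [ (y + n) % m ] ≡⟨ cong₂ _+_ (count-run-∉ y (<⇒≤ n<o) o<m) (count-[-]-≢ c≢) ⟩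
    0                                        ∎
    where
    open ≡-Reasoning
    c = (y + o) % m
    c≢ : c ≢ (y + n) % m
    c≢ eq = <⇒≢ n<o (sym (offset-injective y o<m (<-trans n<o o<m) eq))

  count-run-∈ : ∀ y {o n} → o < n → n ≤ m → count ((y + o) % m) (run y n) ≡ 1
  count-run-∈ y {o} {suc n} o<1+n 1+n≤m with m<1+n⇒m<n∨m≡n o<1+n
  ... | inj₁ o<n  = begin
    count c (run y (suc n))                     ≡⟨ count-run-suc c y n ⟩
    count c (run y n) + count c [ (y + n) % m ] ≡⟨ cong₂ _+_ (count-run-∈ y o<n (<⇒≤ 1+n≤m)) (count-[-]-≢ c≢) ⟩
    1                                           ∎
    where
    open ≡-Reasoning
    c = (y + o) % m
    c≢ : c ≢ (y + n) % m
    c≢ eq = <⇒≢ o<n (offset-injective y (<-trans o<n 1+n≤m) 1+n≤m eq)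
  ... | inj₂ refl = begin
    count c (run y (suc o))                     ≡⟨ count-run-suc c y o ⟩
    count c (run y o) + count c [ c ]           ≡⟨ cong₂ _+_ (count-run-∉ y ≤-refl 1+n≤m) (count-[-]-≡ c) ⟩
    1                                           ∎
    where
    open ≡-Reasoning
    c = (y + o) % m

  count-run-full : ∀ y {c} → c < m → count c (run y m) ≡ 1
  count-run-full y {c} c<m = begin
    count c (run y m)                   ≡⟨ cong (λ a → count a (run y m)) c≡ ⟩
    count ((y + (c ⊖ y)) % m) (run y m) ≡⟨ count-run-∈ y (⊖-< c y) ≤-refl ⟩
    1                                   ∎
    where
    open ≡-Reasoning
    c≡ : c ≡ (y + (c ⊖ y)) % m
    c≡ = trans (sym (m<n⇒m%n≡m c<m)) (sym (+-⊖-≋ y c))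

  -- A run of length 0 < d < m is a proper cyclic interval: the letter just before
  -- its first letter does not occur in it, so its Parikh vector locates its start.
  run-∼⇒≋ : ∀ {y y' d} → 0 < d → d < m → run y d ∼ run y' d → y ≋ y'
  run-∼⇒≋ {y} {y'} {d} 0<d d<m R∼ = shifted-by (y' ⊖ y) (+-⊖-≋ y y') (⊖-< y' y)
    where
    shifted-by : ∀ o → y + o ≋ y' → o < m → y ≋ y'
    shifted-by zero    y+0≋y' _   = trans (cong (_% m) (sym (+-identityʳ y))) y+0≋y'
    shifted-by (suc o) y+o≋y' o<m = contradiction (trans (sym before∈y) (trans (R∼ before (m%n<n _ m)) before∉y')) (0≢1+n ∘ sym)
      where
      start∈y : count ((y + suc o) % m) (run y d) ≡ 1
      start∈y = trans (cong (λ a → count a (run y d)) (trans y+o≋y' (cong (_% m) (sym (+-identityʳ y')))))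
                      (trans (R∼ _ (m%n<n _ m)) (count-run-∈ y' 0<d (<⇒≤ d<m)))
      o<d : suc o < d
      o<d = ≰⇒> (λ d≤o → 0≢1+n (trans (sym (count-run-∉ y d≤o o<m)) start∈y))
      before = (y + o) % m
      before∈y : count before (run y d) ≡ 1
      before∈y = count-run-∈ y (<-trans (n<1+n o) o<d) (<⇒≤ d<m)
      before≡ : before ≡ (y' + pred m) % m
      before≡ = begin
        y + o                   ≈⟨ +m-≋ (y + o) ⟨
        y + o + m               ≡⟨ trans (+-assoc y o m) (cong (λ a → y + (o + a)) (sym (suc-pred m))) ⟩
        y + (o + suc (pred m))  ≡⟨ trans (cong (y +_) (+-suc o (pred m))) (sym (+-assoc y (suc o) (pred m))) ⟩
        y + suc o + pred m      ≈⟨ +ʳ-≋ (pred m) y+o≋y' ⟩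
        y' + pred m             ∎
        where open ≋-Reasoning
      before∉y' : count before (run y' d) ≡ 0
      before∉y' = trans (cong (λ a → count a (run y' d)) before≡)
                        (count-run-∉ y' (<⇒≤pred d<m) (subst (pred m <_) (suc-pred m) (n<1+n (pred m))))

  run-∼⇔ : ∀ {y y' d} → d < m → run y d ∼ run y' d ⇔ (d ≡ 0 ⊎ y ≋ y')
  run-∼⇔ {y} {y'} {zero}  d<m = mk⇔ (λ _ → inj₁ refl) (λ _ _ _ → refl)
  run-∼⇔ {y} {y'} {suc d} d<m = mk⇔ (inj₂ ∘ run-∼⇒≋ z<s d<m) λ where
    (inj₁ ())
    (inj₂ y≋y') c _ → cong (count c) (run-≋ y≋y' (suc d))

modL-% : ∀ m .{{_ : NonZero m}} x → modL m x ≡ x % m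
modL-% (suc n) x = refl

σ-0 : ∀ m .{{_ : NonZero m}} → ∃ λ rest → σ m 0 ≡ 0 ∷ rest
σ-0 (suc n) = _ , refl

module GeneralisedThueMorse (m : ℕ) (1<m : 1 < m) where

  0<m : 0 < m
  0<m = <-trans z<s 1<m

  instance
    m-nonZero : NonZero m
    m-nonZero = >-nonZero 0<m

  open Parikh m
  open Residues m

  length-σ : ∀ i → length (σ m i) ≡ m
  length-σ i = trans (length-map _ (upTo m)) (length-upTo m)

  nth-σ : ∀ i {r} → r < m → nth r (σ m i) ≡ (i + r) % m
  nth-σ i {r} r<m = trans (cong (nth r) (map-upTo (λ k → modL m (i + k)) m))
    (trans (nth-applyUpTo (λ k → modL m (i + k)) r<m) (modL-% m (i + r)))

  length-σ* : ∀ w → length (σ* m w) ≡ length w * m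
  length-σ* []      = refl
  length-σ* (x ∷ w) = trans (length-++ (σ m x)) (cong₂ _+_ (length-σ x) (length-σ* w))

  nth-σ* : ∀ w {q r} → q < length w → r < m → nth (q * m + r) (σ* m w) ≡ (nth q w + r) % m
  nth-σ* (x ∷ w) {zero}  {r} _         r<m = trans (nth-++ˡ (σ m x) _ (subst (r <_) (sym (length-σ x)) r<m)) (nth-σ x r<m)
  nth-σ* (x ∷ w) {suc q} {r} (s<s q<l) r<m = begin
    nth (suc q * m + r) (σ m x ++ σ* m w)               ≡⟨ cong (λ n → nth n (σ m x ++ σ* m w)) position ⟩
    nth (length (σ m x) + (q * m + r)) (σ m x ++ σ* m w) ≡⟨ nth-++ʳ (σ m x) (σ* m w) (q * m + r) ⟩
    nth (q * m + r) (σ* m w)                           ≡⟨ nth-σ* w q<l r<m ⟩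
    (nth q w + r) % m                                  ∎
    where
    open ≡-Reasoning
    position : suc q * m + r ≡ length (σ m x) + (q * m + r)
    position = trans (+-assoc m (q * m) r) (cong (_+ (q * m + r)) (sym (length-σ x)))

  length-σ^ : ∀ j → length (σ^ m j) ≡ m ^ j
  length-σ^ zero    = refl
  length-σ^ (suc j) = trans (length-σ* (σ^ m j)) (trans (cong (_* m) (length-σ^ j)) (*-comm (m ^ j) m))

  σ^-prefix : ∀ j → ∃ λ rest → σ^ m (suc j) ≡ σ^ m j ++ rest
  σ^-prefix zero    with rest , eq ← σ-0 m = rest ++ [] , cong (_++ []) eq
  σ^-prefix (suc j) with rest , eq ← σ^-prefix j = σ* m rest , trans (cong (σ* m) eq) (concatMap-++ (σ m) (σ^ m j) rest)

  n<m^n : ∀ n → n < m ^ n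
  n<m^n zero    = z<s
  n<m^n (suc n) = ≤-<-trans (n<m^n n) (^-monoʳ-< m 1<m (n<1+n n))

  nth-σ^-stable : ∀ d {n j} → n < m ^ j → nth n (σ^ m (d + j)) ≡ nth n (σ^ m j)
  nth-σ^-stable zero    _       = refl
  nth-σ^-stable (suc d) {n} {j} n<m^j with rest , eq ← σ^-prefix (d + j) =
    trans (cong (nth n) eq) (trans (nth-++ˡ (σ^ m (d + j)) rest n<length) (nth-σ^-stable d n<m^j))
    where
    n<length : n < length (σ^ m (d + j))
    n<length = subst (n <_) (sym (length-σ^ (d + j))) (<-≤-trans n<m^j (^-monoʳ-≤ m (m≤n+m j d)))

  t-nth : ∀ {n j} → n < m ^ j → t m n ≡ nth n (σ^ m j)
  t-nth {n} {j} n<m^j with ≤-total j (suc n)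
  ... | inj₁ j≤1+n = trans (cong (λ k → nth n (σ^ m k)) (sym (m∸n+n≡m j≤1+n))) (nth-σ^-stable (suc n ∸ j) n<m^j)
  ... | inj₂ 1+n≤j = sym (trans (cong (λ k → nth n (σ^ m k)) (sym (m∸n+n≡m 1+n≤j)))
                                (nth-σ^-stable (j ∸ suc n) (<-trans (n<1+n n) (n<m^n (suc n)))))

  t-digit : ∀ q {r} → r < m → t m (q * m + r) ≡ (t m q + r) % m
  t-digit q {r} r<m = trans (t-nth {j = suc (suc q)} position<) (nth-σ* (σ^ m (suc q)) q<length r<m)
    where
    q<length : q < length (σ^ m (suc q))
    q<length = subst (q <_) (sym (length-σ^ (suc q))) (<-trans (n<1+n q) (n<m^n (suc q)))
    position< : q * m + r < m ^ suc (suc q)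
    position< = begin-strict
      q * m + r        <⟨ +-monoʳ-< (q * m) r<m ⟩
      q * m + m        ≡⟨ +-comm (q * m) m ⟩
      suc q * m        ≤⟨ *-monoˡ-≤ m (<⇒≤ (n<m^n (suc q))) ⟩
      m ^ suc q * m    ≡⟨ *-comm (m ^ suc q) m ⟩
      m ^ suc (suc q)  ∎
      where open ≤-Reasoning

  n≡[n/m]*m+n%m : ∀ n → n ≡ n / m * m + n % m
  n≡[n/m]*m+n%m n = trans (m≡m%n+[m/n]*n n m) (+-comm (n % m) (n / m * m))

  t-< : ∀ n → t m n < m
  t-< n = subst (λ k → t m k < m) (sym (n≡[n/m]*m+n%m n))
    (subst (_< m) (sym (t-digit (n / m) (m%n<n n m))) (m%n<n _ m))

  t-≋ : ∀ n → t m n ≋ t m (n / m) + n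
  t-≋ n = begin
    t m n                        ≡⟨ cong (t m) (n≡[n/m]*m+n%m n) ⟩
    t m (n / m * m + n % m)      ≡⟨ t-digit (n / m) (m%n<n n m) ⟩
    (t m (n / m) + n % m) % m    ≈⟨ %-≋ _ ⟩
    t m (n / m) + n % m          ≈⟨ +ˡ-≋ (t m (n / m)) (%-≋ n) ⟩
    t m (n / m) + n              ∎
    where open ≋-Reasoning

  t-small : ∀ {r} → r < m → t m r ≡ r
  t-small {r} r<m = trans (t-digit 0 r<m) (trans (cong (λ a → (a + r) % m) t-0) (m<n⇒m%n≡m r<m))
    where
    t-0 : t m 0 ≡ 0
    t-0 with rest , eq ← σ-0 m = cong (nth 0 ∘ (_++ [])) eq

  t-*m : ∀ q → t m (q * m) ≡ t m q
  t-*m q = begin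
    t m (q * m)          ≡⟨ cong (t m) (+-identityʳ (q * m)) ⟨
    t m (q * m + 0)      ≡⟨ t-digit q 0<m ⟩
    (t m q + 0) % m      ≡⟨ cong (_% m) (+-identityʳ (t m q)) ⟩
    t m q % m            ≡⟨ m<n⇒m%n≡m (t-< q) ⟩
    t m q                ∎
    where open ≡-Reasoning

  -- Stepping back suc s letters from the first letter of block suc Q lands in block Q.
  lift-jump : ∀ {s A B} → s < m → (∃ λ Q → t m Q ≋ A + suc s × t m (Q + 1) ≋ B) →
    ∃ λ q → t m q ≋ A × t m (q + suc s) ≋ B
  lift-jump {s} {A} {B} s<m (Q , tQ≋ , tQ+1≋) = Q * m + (m ∸ suc s) , start≋ , end≋
    where
    open ≋-Reasoning
    start≋ : t m (Q * m + (m ∸ suc s)) ≋ A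
    start≋ = begin
      t m (Q * m + (m ∸ suc s))      ≡⟨ t-digit Q (∸-monoʳ-< z<s s<m) ⟩
      (t m Q + (m ∸ suc s)) % m      ≈⟨ %-≋ _ ⟩
      t m Q + (m ∸ suc s)            ≈⟨ +ʳ-≋ (m ∸ suc s) tQ≋ ⟩
      A + suc s + (m ∸ suc s)        ≡⟨ trans (+-assoc A (suc s) _) (cong (A +_) (m+[n∸m]≡n s<m)) ⟩
      A + m                          ≈⟨ +m-≋ A ⟩
      A                              ∎
    end≋ : t m (Q * m + (m ∸ suc s) + suc s) ≋ B
    end≋ = begin
      t m (Q * m + (m ∸ suc s) + suc s)  ≡⟨ cong (t m) (trans (+-assoc (Q * m) _ (suc s)) (cong (Q * m +_) (m∸n+n≡m s<m))) ⟩
      t m (Q * m + m)                     ≡⟨ cong (t m) (+-comm (Q * m) m) ⟩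
      t m (suc Q * m)                     ≡⟨ t-*m (suc Q) ⟩
      t m (suc Q)                         ≡⟨ cong (t m) (+-comm 1 Q) ⟩
      t m (Q + 1)                         ≈⟨ tQ+1≋ ⟩
      B                                   ∎

  consecutive-jump : ∀ d A → ∃ λ q → t m q ≋ A × t m (q + 1) ≋ A + suc d
  consecutive-jump zero A = A % m * m , start≋ , end≋
    where
    tA%m≡ : t m (A % m) ≡ A % m
    tA%m≡ = t-small (m%n<n A m)
    start≋ : t m (A % m * m) ≋ A
    start≋ = trans (cong (_% m) (trans (t-*m (A % m)) tA%m≡)) (%-≋ A)
    end≋ : t m (A % m * m + 1) ≋ A + 1
    end≋ = trans (cong (_% m) (trans (t-digit (A % m) 1<m) (cong (λ a → (a + 1) % m) tA%m≡)))
                 (trans (%-≋ (A % m + 1)) (+ʳ-≋ 1 (%-≋ A)))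
  consecutive-jump (suc d) A with q , tq≋ , tq+1≋ ← lift-jump 0<m (consecutive-jump d (A + 1)) =
    q , tq≋ , trans tq+1≋ (cong (_% m) (+-assoc A 1 (suc d)))

  jumps-surjective : ∀ {s} → s < m → ∀ A d → ∃ λ q → t m q ≋ A × t m (q + suc s) ≋ A + d
  jumps-surjective {s} s<m A d =
    let q , tq≋ , tq+s≋ = lift-jump s<m (consecutive-jump e (A + suc s)) in
    q , tq≋ , trans tq+s≋ (trans (cong (_% m) (+-suc (A + suc s) e)) (+-⊖-≋ (suc (A + suc s)) (A + d)))
    where
    e = (A + d) ⊖ suc (A + suc s)

  block : ∀ q {r n} → r + n ≤ m → factor m (q * m + r) n ≡ run (t m q + r) n
  block q {r} {n} r+n≤m = trans (factor-applyUpTo m (q * m + r) n) (applyUpTo-cong-< n letter)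
    where
    letter : ∀ {j} → j < n → t m (q * m + r + j) ≡ (t m q + r + j) % m
    letter {j} j<n = begin
      t m (q * m + r + j)      ≡⟨ cong (t m) (+-assoc (q * m) r j) ⟩
      t m (q * m + (r + j))    ≡⟨ t-digit q (<-≤-trans (+-monoʳ-< r j<n) r+n≤m) ⟩
      (t m q + (r + j)) % m    ≡⟨ cong (_% m) (+-assoc (t m q) r j) ⟨
      (t m q + r + j) % m      ∎
      where open ≡-Reasoning

  block-start : ∀ q {n} → n ≤ m → factor m (q * m) n ≡ run (t m q) n
  block-start q {n} n≤m = subst₂ (λ i y → factor m i n ≡ run y n) (+-identityʳ (q * m)) (+-identityʳ (t m q)) (block q n≤m)

  -- (Q * m + n) / m is the block of the last letter, Q or suc Q.
  count-factor-from-block : ∀ Q {n} → n < m + m → ∀ {c} → c < m →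
    count c (factor m (Q * m) (suc n)) ≡ count c (run (t m ((Q * m + n) / m)) (suc n))
  count-factor-from-block Q {n} n<2m {c} c<m with n <? m
  ... | yes n<m = cong (count c) (trans (block-start Q n<m) (cong (λ q → run (t m q) (suc n)) (sym ([q*m+r]/m≡q Q n<m))))
  ... | no  n≮m with e , refl ← m≤n⇒∃[o]m+o≡n (≮⇒≥ n≮m) = begin
    count c (factor m (Q * m) (suc (m + e)))                         ≡⟨ cong (count c ∘ factor m (Q * m)) (sym (+-suc m e)) ⟩
    count c (factor m (Q * m) (m + suc e))                           ≡⟨ cong (count c) (factor-+ m (Q * m) m (suc e)) ⟩
    count c (factor m (Q * m) m ++ factor m (Q * m + m) (suc e))     ≡⟨ count-++ c (factor m (Q * m) m) (factor m (Q * m + m) (suc e)) ⟩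
    count c (factor m (Q * m) m) + count c (factor m (Q * m + m) (suc e))
      ≡⟨ cong₂ (λ w i → count c w + count c (factor m i (suc e))) (block-start Q ≤-refl) (+-comm (Q * m) m) ⟩
    count c (run (t m Q) m) + count c (factor m (suc Q * m) (suc e))
      ≡⟨ cong₂ (λ a w → a + count c w) (trans (count-run-full (t m Q) c<m) (sym (count-run-full C c<m))) (block-start (suc Q) e<m) ⟩
    count c (run C m) + count c (run C (suc e))                      ≡⟨ cong (λ w → count c (run C m) + count c w) (run-≋ (+m-≋ C) (suc e)) ⟨
    count c (run C m) + count c (run (C + m) (suc e))                ≡⟨ count-run-+ c C m (suc e) ⟨
    count c (run C (m + suc e))                                      ≡⟨ cong (λ n → count c (run C n)) (+-suc m e) ⟩
    count c (run C (suc (m + e)))                                    ≡⟨ cong (λ q → count c (run (t m q) (suc (m + e)))) (sym next-block) ⟩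
    count c (run (t m ((Q * m + (m + e)) / m)) (suc (m + e)))       ∎
    where
    open ≡-Reasoning
    e<m : suc e ≤ m
    e<m = +-cancelˡ-< m e m n<2m
    C = t m (suc Q)
    next-block : (Q * m + (m + e)) / m ≡ suc Q
    next-block = trans (cong (_/ m) (trans (sym (+-assoc (Q * m) m e)) (cong (_+ e) (+-comm (Q * m) m)))) ([q*m+r]/m≡q (suc Q) (≤-trans (n<1+n e) e<m))

module AbelianRauzyGraph (m : ℕ) (1<m : 1 < m) (k : ℕ) (k<m : k < m) where

  open GeneralisedThueMorse m 1<m
  open Parikh m
  open Residues m

  ℓ : ℕ
  ℓ = m + k

  open RauzyEdges m ℓ

  -- The window at i is read from block i / m to block (i + ℓ) / m of t_m; its jump is
  -- the difference of the letters of t_m indexing these two blocks.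
  jump : ℕ → ℕ
  jump i = t m ((i + ℓ) / m) ⊖ t m (i / m)

  last-letter : ∀ i → t m (i + ℓ) ≋ t m i + ℓ + jump i
  last-letter i = begin
    t m (i + ℓ)                  ≈⟨ t-≋ (i + ℓ) ⟩
    z + (i + ℓ)                  ≈⟨ +ʳ-≋ (i + ℓ) (+-⊖-≋ y z) ⟨
    y + jump i + (i + ℓ)         ≡⟨ rearrange y (jump i) i ℓ ⟩
    y + i + ℓ + jump i           ≈⟨ +ʳ-≋ (jump i) (+ʳ-≋ ℓ (t-≋ i)) ⟨
    t m i + ℓ + jump i           ∎
    where
    open ≋-Reasoning
    y = t m (i / m)
    z = t m ((i + ℓ) / m)
    rearrange : ∀ a b c d → a + b + (c + d) ≡ a + c + d + b
    rearrange = solve-∀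

  last-letter-≡⇔ : ∀ {i j} → t m i ≡ t m j → (t m (i + ℓ) ≡ t m (j + ℓ) ⇔ jump i ≡ jump j)
  last-letter-≡⇔ {i} {j} x≡ = mk⇔
    (λ L≡ → ≋⇒≡ (⊖-< _ _) (⊖-< _ _) (≋-cancelˡ (t m i + ℓ)
      (trans (sym (last-letter i)) (trans (cong (_% m) L≡) (trans (last-letter j) (cong (λ x → (x + ℓ + jump j) % m) (sym x≡)))))))
    (λ d≡ → ≋⇒≡ (t-< (i + ℓ)) (t-< (j + ℓ))
      (trans (last-letter i) (trans (cong₂ (λ x d → (x + ℓ + d) % m) x≡ d≡) (sym (last-letter j)))))

  -- Prefixing the window with the first i % m letters of its block gives a full block
  -- followed by a factor starting at a block boundary.
  count-window : ∀ i {c} → c < m →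
    count c (run (t m (i / m)) (i % m)) + count c (window i)
      ≡ 1 + count c (run (t m (i / m) + jump i) (i % m + suc k))
  count-window i {c} c<m = begin
    count c (run y r) + count c (window i)
      ≡⟨ cong₂ (λ w j → count c w + count c (factor m j (suc ℓ))) (block-start q r≤m) (sym i≡) ⟨
    count c (factor m (q * m) r) + count c (factor m (q * m + r) (suc ℓ))
      ≡⟨ trans (cong (count c) (factor-+ m (q * m) r (suc ℓ))) (count-++ c (factor m (q * m) r) _) ⟨
    count c (factor m (q * m) (r + suc ℓ))
      ≡⟨ cong (count c ∘ factor m (q * m)) (lengths r m k) ⟩
    count c (factor m (q * m) (m + suc (r + k)))
      ≡⟨ trans (cong (count c) (factor-+ m (q * m) m _)) (count-++ c (factor m (q * m) m) _) ⟩
    count c (factor m (q * m) m) + count c (factor m (q * m + m) (suc (r + k)))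
      ≡⟨ cong₂ (λ w j → count c w + count c (factor m j (suc (r + k)))) (block-start q ≤-refl) (+-comm (q * m) m) ⟩
    count c (run y m) + count c (factor m (suc q * m) (suc (r + k)))
      ≡⟨ cong₂ _+_ (count-run-full y c<m) (count-factor-from-block (suc q) (+-mono-< (m%n<n i m) k<m) c<m) ⟩
    1 + count c (run (t m ((suc q * m + (r + k)) / m)) (suc (r + k)))
      ≡⟨ cong (λ j → 1 + count c (run (t m (j / m)) (suc (r + k)))) last-position ⟩
    1 + count c (run z (suc (r + k)))
      ≡⟨ cong (λ w → 1 + count c w) (trans (run-≋ (sym (+-⊖-≋ y z)) (suc (r + k))) (cong (run (y + jump i)) (sym (+-suc r k)))) ⟩
    1 + count c (run (y + jump i) (r + suc k)) ∎
    where
    open ≡-Reasoning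
    q = i / m
    r = i % m
    y = t m q
    z = t m ((i + ℓ) / m)
    r≤m : r ≤ m
    r≤m = <⇒≤ (m%n<n i m)
    i≡ : i ≡ q * m + r
    i≡ = n≡[n/m]*m+n%m i
    lengths : ∀ r m k → r + suc (m + k) ≡ m + suc (r + k)
    lengths = solve-∀
    last-position : suc q * m + (r + k) ≡ i + ℓ
    last-position = trans (rearrange (q * m) r m k) (cong (_+ ℓ) (sym i≡))
      where
      rearrange : ∀ a b c d → c + a + (b + d) ≡ a + b + (c + d)
      rearrange = solve-∀

  parikh-identity : ∀ i {c} → c < m →
    count c (window i) + count c (run (t m (i / m)) (jump i)) ≡ 1 + count c (run (t m i) (suc k + jump i))
  parikh-identity i {c} c<m = +-cancelˡ-≡ (count c (run y r)) _ _ (begin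
    count c (run y r) + (count c (window i) + count c (run y d))      ≡⟨ +-assoc (count c (run y r)) _ _ ⟨
    count c (run y r) + count c (window i) + count c (run y d)        ≡⟨ cong (_+ count c (run y d)) (count-window i c<m) ⟩
    1 + count c (run (y + d) (r + suc k)) + count c (run y d)         ≡⟨ cong suc (+-comm (count c (run (y + d) (r + suc k))) _) ⟩
    1 + (count c (run y d) + count c (run (y + d) (r + suc k)))       ≡⟨ cong suc (count-run-+ c y d (r + suc k)) ⟨
    1 + count c (run y (d + (r + suc k)))                             ≡⟨ cong (λ n → 1 + count c (run y n)) (lengths d r (suc k)) ⟩
    1 + count c (run y (r + (suc k + d)))                             ≡⟨ cong suc (count-run-+ c y r (suc k + d)) ⟩
    1 + (count c (run y r) + count c (run (y + r) (suc k + d)))       ≡⟨ cong (λ w → 1 + (count c (run y r) + count c w)) (run-≋ y+r≋x (suc k + d)) ⟩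
    1 + (count c (run y r) + count c (run (t m i) (suc k + d)))       ≡⟨ +-suc (count c (run y r)) _ ⟨
    count c (run y r) + (1 + count c (run (t m i) (suc k + d)))       ∎)
    where
    open ≡-Reasoning
    y = t m (i / m)
    r = i % m
    d = jump i
    y+r≋x : y + r ≋ t m i
    y+r≋x = trans (+ˡ-≋ y (%-≋ i)) (sym (t-≋ i))
    lengths : ∀ d r k → d + (r + k) ≡ r + (k + d)
    lengths = solve-∀

  block-letter-≋⇔ : ∀ {i j} → t m i ≡ t m j → (t m (i / m) ≋ t m (j / m) ⇔ i ≋ j)
  block-letter-≋⇔ {i} {j} x≡ = mk⇔
    (λ y≋ → ≋-cancelˡ (t m (i / m)) (trans yi+i≋yj+j (sym (+ʳ-≋ j y≋))))
    (λ i≋j → ≋-cancelʳ i (trans yi+i≋yj+j (sym (+ˡ-≋ (t m (j / m)) i≋j))))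
    where
    yi+i≋yj+j : t m (i / m) + i ≋ t m (j / m) + j
    yi+i≋yj+j = trans (sym (t-≋ i)) (trans (cong (_% m) x≡) (t-≋ j))

  window-∼⇔ : ∀ {i j} → t m i ≡ t m j → jump i ≡ jump j →
    (window i ∼ window j ⇔ run (t m (i / m)) (jump i) ∼ run (t m (j / m)) (jump i))
  window-∼⇔ {i} {j} x≡ d≡ = mk⇔
    (λ W∼ c c<m → +-cancelˡ-≡ (count c (window i)) _ _
       (trans (parikh-identity i c<m) (trans (sym (identity-j c<m)) (cong (_+ count c (run (t m (j / m)) (jump i))) (sym (W∼ c c<m))))))
    (λ R∼ c c<m → +-cancelʳ-≡ _ _ _
       (trans (parikh-identity i c<m) (trans (sym (identity-j c<m)) (cong (count c (window j) +_) (sym (R∼ c c<m))))))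
    where
    identity-j : ∀ {c} → c < m →
      count c (window j) + count c (run (t m (j / m)) (jump i)) ≡ 1 + count c (run (t m i) (suc k + jump i))
    identity-j {c} c<m = subst₂ (λ x d → count c (window j) + count c (run (t m (j / m)) d) ≡ 1 + count c (run x (suc k + d)))
      (sym x≡) (sym d≡) (parikh-identity j c<m)

  phase : ℕ → ℕ → ℕ
  phase zero    _ = 0
  phase (suc _) r = r

  phase-≡⇔ : ∀ d {r r'} → phase d r ≡ phase d r' ⇔ (d ≡ 0 ⊎ r ≡ r')
  phase-≡⇔ zero    = mk⇔ (λ _ → inj₁ refl) (λ _ → refl)
  phase-≡⇔ (suc d) = mk⇔ inj₂ λ where
    (inj₁ ())
    (inj₂ r≡r') → r≡r'

  -- With jump 0 the Parikh vector of the window does not depend on i % m, which is then forgotten.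
  key : ℕ → ℕ × ℕ × ℕ
  key i = t m i , jump i , phase (jump i) (i % m)

  key-≡⇔ : ∀ {i j} → key i ≡ key j ⇔ (t m i ≡ t m j × jump i ≡ jump j × (jump i ≡ 0 ⊎ i ≋ j))
  key-≡⇔ {i} {j} = mk⇔
    (λ e → let d≡ = cong (proj₁ ∘ proj₂) e in
       cong proj₁ e , d≡ , to (phase-≡⇔ (jump i)) (trans (cong (proj₂ ∘ proj₂) e) (cong (λ d → phase d (j % m)) (sym d≡))))
    (λ (x≡ , d≡ , h) → cong₂ _,_ x≡ (cong₂ _,_ d≡ (trans (from (phase-≡⇔ (jump i)) h) (cong (λ d → phase d (j % m)) d≡))))

  window-∼⇔phase : ∀ {i j} → t m i ≡ t m j → jump i ≡ jump j → (window i ∼ window j ⇔ (jump i ≡ 0 ⊎ i ≋ j))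
  window-∼⇔phase {i} {j} x≡ d≡ =
    (⇔-id (jump i ≡ 0) ⊎-⇔ block-letter-≋⇔ {i} {j} x≡) ⇔-∘ (run-∼⇔ (⊖-< _ _) ⇔-∘ window-∼⇔ {i} {j} x≡ d≡)

  edgeAt-≡⇔key-≡ : ∀ {i j} → edgeAt m ℓ i ≡ edgeAt m ℓ j ⇔ key i ≡ key j
  edgeAt-≡⇔key-≡ {i} {j} = mk⇔
    (λ e → let x≡ , L≡ , W∼ = to (edgeAt-≡⇔ {i} {j}) e ; d≡ = to (last-letter-≡⇔ {i} {j} x≡) L≡ in
       from (key-≡⇔ {i} {j}) (x≡ , d≡ , to (window-∼⇔phase {i} {j} x≡ d≡) W∼))
    (λ e → let x≡ , d≡ , h = to (key-≡⇔ {i} {j}) e in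
       from (edgeAt-≡⇔ {i} {j}) (x≡ , from (last-letter-≡⇔ {i} {j} x≡) d≡ , from (window-∼⇔phase {i} {j} x≡ d≡) h))

  [r%m+k]/m<m : ∀ r → (r % m + k) / m < m
  [r%m+k]/m<m r = m<n*o⇒m/o<n (begin-strict
    r % m + k      <⟨ +-mono-< (m%n<n r m) k<m ⟩
    m + m          ≡⟨ cong (m +_) (+-identityʳ m) ⟨
    2 * m          ≤⟨ *-monoˡ-≤ m 1<m ⟩
    m * m          ∎)
    where open ≤-Reasoning

  position : ℕ × ℕ × ℕ → ℕ
  position (x , d , r) = proj₁ (jumps-surjective ([r%m+k]/m<m r) (x ⊖ r) d) * m + r % m

  key-position : ∀ {x d r} → x < m → d < m →
    key (position (x , d , r)) ≡ (x , d , phase d (r % m))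
  key-position {x} {d} {r} x<m d<m =
    cong₂ _,_ x≡ (cong₂ _,_ d≡ (trans (cong (phase (jump i)) i%m≡) (cong (λ e → phase e (r % m)) d≡)))
    where
    s = (r % m + k) / m
    witness = jumps-surjective ([r%m+k]/m<m r) (x ⊖ r) d
    q = proj₁ witness
    tq≋ = proj₁ (proj₂ witness)
    tq+s≋ = proj₂ (proj₂ witness)
    i = q * m + r % m
    i/m≡ : i / m ≡ q
    i/m≡ = [q*m+r]/m≡q q (m%n<n r m)
    i%m≡ : i % m ≡ r % m
    i%m≡ = [q*m+r]%m≡r q (m%n<n r m)
    x≡ : t m i ≡ x
    x≡ = ≋⇒≡ (t-< i) x<m (begin
      t m i                 ≡⟨ t-digit q (m%n<n r m) ⟩
      (t m q + r % m) % m   ≈⟨ %-≋ _ ⟩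
      t m q + r % m         ≈⟨ +-≋ tq≋ (%-≋ r) ⟩
      x ⊖ r + r             ≡⟨ +-comm (x ⊖ r) r ⟩
      r + (x ⊖ r)           ≈⟨ +-⊖-≋ r x ⟩
      x                     ∎)
      where open ≋-Reasoning
    last-block : (i + ℓ) / m ≡ q + suc s
    last-block = begin
      (i + ℓ) / m                       ≡⟨ cong (_/ m) (rearrange (q * m) (r % m) m k) ⟩
      (suc q * m + (r % m + k)) / m     ≡⟨ [q*m+n]/m≡q+n/m (suc q) (r % m + k) ⟩
      suc q + s                         ≡⟨ +-suc q s ⟨
      q + suc s                         ∎
      where
      open ≡-Reasoning
      rearrange : ∀ a b c d → a + b + (c + d) ≡ c + a + (b + d)
      rearrange = solve-∀
    d≡ : jump i ≡ d
    d≡ = ⊖-unique d<m (begin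
      t m (i / m) + d            ≡⟨ cong (λ q → t m q + d) i/m≡ ⟩
      t m q + d                  ≈⟨ +ʳ-≋ d tq≋ ⟩
      x ⊖ r + d                  ≈⟨ tq+s≋ ⟨
      t m (q + suc s)            ≡⟨ cong (t m) last-block ⟨
      t m ((i + ℓ) / m)          ∎)
      where open ≋-Reasoning

  phases : List (ℕ × ℕ)
  phases = (0 , 0) ∷ cartesianProduct (map suc (upTo (pred m))) (upTo m)

  keys : List (ℕ × ℕ × ℕ)
  keys = cartesianProduct (upTo m) phases

  keys! : Unique keys
  keys! = cartesianProduct⁺ (upTo⁺ m) (All.tabulate 0,0∉ ∷ cartesianProduct⁺ (map⁺ suc-injective (upTo⁺ (pred m))) (upTo⁺ m))
    where
    0,0∉ : ∀ {dr} → dr ∈ cartesianProduct (map suc (upTo (pred m))) (upTo m) → (0 , 0) ≢ dr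
    0,0∉ dr∈ refl with d∈ , _ ← ∈-cartesianProduct⁻ (map suc (upTo (pred m))) (upTo m) dr∈
                  with _ , _ , () ← ∈-map⁻ suc d∈

  length-keys : length keys ≡ m * (m * m ∸ m + 1)
  length-keys = begin
    length keys                                  ≡⟨ length-cartesianProduct (upTo m) phases ⟩
    length (upTo m) * length phases              ≡⟨ cong₂ (λ a b → a * suc b) (length-upTo m) (length-cartesianProduct (map suc (upTo (pred m))) (upTo m)) ⟩
    m * suc (length (map suc (upTo (pred m))) * length (upTo m))
      ≡⟨ cong₂ (λ a b → m * suc (a * b)) (trans (length-map suc (upTo (pred m))) (length-upTo (pred m))) (length-upTo m) ⟩
    m * suc (pred m * m)                         ≡⟨ cong (m *_) (+-comm 1 (pred m * m)) ⟩
    m * (pred m * m + 1)                         ≡⟨ cong (λ a → m * (a + 1)) (sym (trans (cong (λ n → n * m ∸ m) (sym (suc-pred m))) (m+n∸m≡n m (pred m * m)))) ⟩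
    m * (m * m ∸ m + 1)                          ∎
    where open ≡-Reasoning

  key∈keys : ∀ i → key i ∈ keys
  key∈keys i = ∈-cartesianProduct⁺ (∈-upTo⁺ (t-< i)) (phase∈ (jump i) (⊖-< _ _))
    where
    phase∈ : ∀ d → d < m → (d , phase d (i % m)) ∈ phases
    phase∈ zero    _   = here refl
    phase∈ (suc d) d<m = there (∈-cartesianProduct⁺ (∈-map⁺ suc (∈-upTo⁺ (<⇒≤pred d<m))) (∈-upTo⁺ (m%n<n i m)))

  phases-valid : ∀ {d r} → (d , r) ∈ phases → d < m × phase d (r % m) ≡ r
  phases-valid (here refl)  = 0<m , refl
  phases-valid (there dr∈)
    with d∈ , r∈ ← ∈-cartesianProduct⁻ (map suc (upTo (pred m))) (upTo m) dr∈
    with _ , d'∈ , refl ← ∈-map⁻ suc d∈ = m≤pred[n]⇒suc[m]≤n (∈-upTo⁻ d'∈) , m<n⇒m%n≡m (∈-upTo⁻ r∈)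

  key-position∈ : ∀ {κ} → κ ∈ keys → key (position κ) ≡ κ
  key-position∈ {x , d , r} κ∈ with x∈ , dr∈ ← ∈-cartesianProduct⁻ (upTo m) phases κ∈ =
    let d<m , phase≡ = phases-valid dr∈ in
    trans (key-position (∈-upTo⁻ x∈) d<m) (cong (λ ρ → x , d , ρ) phase≡)

  numEdges : NumEdges m ℓ (m * (m * m ∸ m + 1))
  numEdges = subst (NumEdges m ℓ) length-keys
    (NumValues-byKeys keys position keys! key∈keys key-position∈ edgeAt-≡⇔key-≡)

proposition9p7 : (m ℓ : ℕ) → 2 ≤ m → m ≤ ℓ → ℓ < 2 * m →
    NumEdges m ℓ (m * (m * m ∸ m + 1))
proposition9p7 m ℓ 2≤m m≤ℓ ℓ<2m with k , refl ← m≤n⇒∃[o]m+o≡n m≤ℓ =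
  AbelianRauzyGraph.numEdges m 2≤m k (+-cancelˡ-< m k m (subst (λ n → m + k < m + n) (+-identityʳ m) ℓ<2m))
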